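{- Let $k,d,n$ be positive integers with $n \ge d = 2k$. Then the family of functions $\{\mathbbm{1}_{S^d} : S \in \mathcal{I}_k\}$, viewed as functions $[n]^d \to \mathbb{F}_2$, is linearly independent over $\mathbb{F}_2$.
   Context: $[n]=\{1,\dots,n\}$; for integers $a \le b$, $[a,b]=\{a,\dots,b\}$ is an interval. $\mathcal{I}_k$ denotes the set of non-empty subsets of $[n]$ that are unions of at most $k$ intervals. $S^d = S \times\dots\times S\subset [n]^d$, and $\mathbbm{1}_X$ is the indicator function of $X$. -}

module Defs where

open import Data.Nat using (ℕ; zero; suc; _≤_)
open import Data.Bool using (Bool; true; false; _∧_; _xor_)
open import Data.Fin using (Fin; toℕ)
import Data.Fin as F
open import Data.Fin.Subset using (Subset; _∪_; Nonempty) renaming (⊥ to ∅)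
open import Data.Vec using (tabulate; lookup)
open import Data.List using (List; foldr; map; length)
open import Data.List.Relation.Unary.All using (All)
open import Data.Product using (_×_; Σ; ∃; proj₁; proj₂)
open import Relation.Binary.PropositionalEquality using (_≡_)
open import Relation.Nullary.Decidable using (⌊_⌋)
open import Data.Nat using (_≤?_)

-- [n] is modelled by Fin n (0-indexed); subsets of [n] by Data.Fin.Subset.
-- The interval [a,b] = { i | a ≤ i ≤ b } as a subset of [n].
interval : ∀ {n} → Fin n → Fin n → Subset n
interval a b = tabulate (λ i → ⌊ toℕ a ≤? toℕ i ⌋ ∧ ⌊ toℕ i ≤? toℕ b ⌋)

unionOfIntervals : ∀ {n} → List (Fin n × Fin n) → Subset n
unionOfIntervals = foldr (λ p acc → interval (proj₁ p) (proj₂ p) ∪ acc) ∅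

ValidInterval : ∀ {n} → Fin n × Fin n → Set
ValidInterval p = toℕ (proj₁ p) ≤ toℕ (proj₂ p)

InI : ∀ {n} → ℕ → Subset n → Set
InI {n} k S =
  Nonempty S ×
  Σ (List (Fin n × Fin n)) (λ ivs →
      (length ivs ≤ k) × All ValidInterval ivs × (S ≡ unionOfIntervals ivs))

-- 𝟙_{S^d}(x) ∈ 𝔽₂ (Bool), for x ∈ [n]^d given as Fin d → Fin n
indPow : ∀ {n} (d : ℕ) → Subset n → (Fin d → Fin n) → Bool
indPow zero S x = true
indPow (suc d) S x = lookup S (x F.zero) ∧ indPow d S (λ i → x (F.suc i))

sumF2 : ∀ {n} (d : ℕ) → List (Subset n) → (Fin d → Fin n) → Bool
sumF2 d L x = foldr (λ S b → indPow d S x xor b) false L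

-- Record S ⊆ [n] by its boundary ∂S ⊆ {0, …, n}: the j with 𝟙_S(j) ≠ 𝟙_S(j+1), where
-- 𝟙_S(0) = 𝟙_S(n+1) = 0. S is determined by ∂S, and a union of at most k intervals has
-- |∂S| ≤ 2k = d. Given a non-empty family L, pick S₀ ∈ L with |∂S₀| maximal;
-- then S₀ is the only S ∈ L with ∂S₀ ⊆ ∂S, so over 𝔽₂
--   ∑_{S ∈ L} ∏_{j ∈ ∂S₀} (𝟙_S(j) + 𝟙_S(j+1)) = 1.
-- Expanding the product, some monomial ∏_{r ∈ R} 𝟙_S(r) with |R| = |∂S₀| ≤ d has odd sum over L,
-- and a point x ∈ [n]^d listing R (with repetitions) has 𝟙_{S^d}(x) = ∏_{r ∈ R} 𝟙_S(r).
module Submission where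

open import Defs
open import Data.Bool using (Bool; true; false; not; _∧_; _∨_; _xor_)
open import Data.Bool.Properties
  using (∧-assoc; ∧-idem; ∧-identityʳ; ∧-zeroʳ; ∧-distribˡ-xor; ∧-distribʳ-xor;
         xor-identityʳ; not-injective; ¬-not; xor-∧-commutativeRing)
open import Algebra.Bundles using (CommutativeRing)
open import Algebra.Properties.CommutativeSemigroup
  (CommutativeRing.+-commutativeSemigroup xor-∧-commutativeRing) using (interchange)
open import Data.Empty using (⊥-elim)
open import Data.Fin using (Fin; toℕ; zero; suc)
open import Data.Fin.Subset
  using (Subset; _∪_; _⊆_; _∈_; ∣_∣; Nonempty; inside; outside) renaming (⊥ to ∅)
open import Data.Fin.Subset.Properties
  using (p⊆q⇒∣p∣≤∣q∣; ∣p∣≤∣x∷p∣; ∣⊥∣≡0; ∉⊥; drop-∷-⊆; ⊆-refl)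
open import Data.List using (List; []; _∷_; length; foldr)
open import Data.Bool.ListAction using (all)
import Data.List.Membership.Propositional as List
open import Data.List.Relation.Unary.Any using (here; there)
open import Data.List.Relation.Unary.All using (All; _∷_)
import Data.List.Relation.Unary.All as All
open import Data.List.Relation.Unary.AllPairs using (_∷_)
open import Data.List.Relation.Unary.Unique.Propositional using (Unique)
open import Data.List.Extrema.Nat using (argmax; argmax-all; f[⊥]≤f[argmax]; f[xs]≤f[argmax])
open import Data.Nat using (ℕ; zero; suc; _+_; _*_; _≤_; _<_; _≤ᵇ_; _≤?_; z≤n; s≤s)
open import Data.Nat.Properties
  using (≤-refl; ≤-reflexive; ≤-trans; ≤-pred; <⇒≱; <⇒≢; +-suc; +-mono-≤; *-monoʳ-≤; *-suc;
         n≢0⇒n>0; module ≤-Reasoning)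
open import Data.Product using (_×_; ∃; _,_; proj₁; proj₂)
open import Data.Sum using (_⊎_; inj₁; inj₂; [_,_]′)
open import Data.Vec using ([]; _∷_; lookup; tabulate; here; there)
open import Data.Vec.Properties using (∷-injectiveˡ; ∷-injectiveʳ; tabulate-cong)
open import Relation.Nullary.Decidable using (isYes≗does)
open import Relation.Binary.PropositionalEquality

private
  variable
    A : Set
    n : ℕ

∧-true⁻ : ∀ {a b} → a ∧ b ≡ true → a ≡ true × b ≡ true
∧-true⁻ {true} b≡true = refl , b≡true

xor-true⁻ : ∀ a {b} → a xor b ≡ true → a ≡ true ⊎ b ≡ true
xor-true⁻ true  _      = inj₁ refl
xor-true⁻ false b≡true = inj₂ b≡true

xor-cancelˡ : ∀ a {b c} → a xor b ≡ a xor c → b ≡ c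
xor-cancelˡ false eq = eq
xor-cancelˡ true  eq = not-injective eq

∨-xor-∨ : ∀ a b c d → (a ∨ b) xor (c ∨ d) ≡ true → (a xor c) ∨ (b xor d) ≡ true
∨-xor-∨ true  b true  d ()
∨-xor-∨ true  b false d _ = refl
∨-xor-∨ false b true  d _ = refl
∨-xor-∨ false b false d h = h

∣p∪q∣≤∣p∣+∣q∣ : (p q : Subset n) → ∣ p ∪ q ∣ ≤ ∣ p ∣ + ∣ q ∣
∣p∪q∣≤∣p∣+∣q∣ [] [] = z≤n
∣p∪q∣≤∣p∣+∣q∣ (inside ∷ p) (y ∷ q) =
  s≤s (≤-trans (∣p∪q∣≤∣p∣+∣q∣ p q) (+-mono-≤ ≤-refl (∣p∣≤∣x∷p∣ y q)))
∣p∪q∣≤∣p∣+∣q∣ (outside ∷ p) (outside ∷ q) = ∣p∪q∣≤∣p∣+∣q∣ p q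
∣p∪q∣≤∣p∣+∣q∣ (outside ∷ p) (inside ∷ q) =
  ≤-trans (s≤s (∣p∪q∣≤∣p∣+∣q∣ p q)) (≤-reflexive (sym (+-suc ∣ p ∣ ∣ q ∣)))

p⊆q∧∣q∣≤∣p∣⇒p≡q : {p q : Subset n} → p ⊆ q → ∣ q ∣ ≤ ∣ p ∣ → p ≡ q
p⊆q∧∣q∣≤∣p∣⇒p≡q {p = []} {[]} _ _ = refl
p⊆q∧∣q∣≤∣p∣⇒p≡q {p = inside ∷ p} {inside ∷ q} p⊆q ∣q∣≤∣p∣ =
  cong (inside ∷_) (p⊆q∧∣q∣≤∣p∣⇒p≡q (drop-∷-⊆ p⊆q) (≤-pred ∣q∣≤∣p∣))
p⊆q∧∣q∣≤∣p∣⇒p≡q {p = inside ∷ p} {outside ∷ q} p⊆q _ with p⊆q here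
... | ()
p⊆q∧∣q∣≤∣p∣⇒p≡q {p = outside ∷ p} {outside ∷ q} p⊆q ∣q∣≤∣p∣ =
  cong (outside ∷_) (p⊆q∧∣q∣≤∣p∣⇒p≡q (drop-∷-⊆ p⊆q) ∣q∣≤∣p∣)
p⊆q∧∣q∣≤∣p∣⇒p≡q {p = outside ∷ p} {inside ∷ q} p⊆q ∣q∣≤∣p∣ =
  ⊥-elim (<⇒≱ ∣q∣≤∣p∣ (p⊆q⇒∣p∣≤∣q∣ (drop-∷-⊆ p⊆q)))

∣p∣≡0⇒p≡⊥ : {p : Subset n} → ∣ p ∣ ≡ 0 → p ≡ ∅
∣p∣≡0⇒p≡⊥ {p = []} _ = refl
∣p∣≡0⇒p≡⊥ {p = outside ∷ p} ∣p∣≡0 = cong (outside ∷_) (∣p∣≡0⇒p≡⊥ ∣p∣≡0)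

-- The 0/1 sequence  b, 𝟙_S(0), …, 𝟙_S(n-1), 0, 0, …  (position i of S sits at index i+1).
extend : Bool → Subset n → ℕ → Bool
extend b S       zero    = b
extend b []      (suc m) = false
extend b (s ∷ S) (suc m) = extend s S m

boundaryFrom : Bool → Subset n → Subset (suc n)
boundaryFrom b []      = b ∷ []
boundaryFrom b (s ∷ S) = (b xor s) ∷ boundaryFrom s S

∂ : Subset n → Subset (suc n)
∂ = boundaryFrom false

lookup-boundaryFrom : ∀ b (S : Subset n) j →
  lookup (boundaryFrom b S) j ≡ extend b S (toℕ j) xor extend b S (suc (toℕ j))
lookup-boundaryFrom b []      zero    = sym (xor-identityʳ b)
lookup-boundaryFrom b (s ∷ S) zero    = refl
lookup-boundaryFrom b (s ∷ S) (suc j) = lookup-boundaryFrom s S j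

boundaryFrom-injective : ∀ b {S T : Subset n} → boundaryFrom b S ≡ boundaryFrom b T → S ≡ T
boundaryFrom-injective b {[]}    {[]}    _  = refl
boundaryFrom-injective b {s ∷ S} {t ∷ T} eq with xor-cancelˡ b (∷-injectiveˡ eq)
... | refl = cong (s ∷_) (boundaryFrom-injective s (∷-injectiveʳ eq))

∂-⊥ : ∀ n → ∂ (∅ {n}) ≡ ∅
∂-⊥ zero    = refl
∂-⊥ (suc n) = cong (outside ∷_) (∂-⊥ n)

∣∂⊥∣≡0 : ∀ n → ∣ ∂ (∅ {n}) ∣ ≡ 0
∣∂⊥∣≡0 n = trans (cong ∣_∣ (∂-⊥ n)) (∣⊥∣≡0 (suc n))

∷-⊆ : ∀ {a b} {p q : Subset n} → (a ≡ true → b ≡ true) → p ⊆ q → a ∷ p ⊆ b ∷ q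
∷-⊆ a⇒b _ here with a⇒b refl
... | refl = here
∷-⊆ _ p⊆q (there x∈p) = there (p⊆q x∈p)

boundaryFrom-∪ : ∀ a b (S T : Subset n) →
  boundaryFrom (a ∨ b) (S ∪ T) ⊆ boundaryFrom a S ∪ boundaryFrom b T
boundaryFrom-∪ a b []      []      = λ x∈ → x∈
boundaryFrom-∪ a b (s ∷ S) (t ∷ T) = ∷-⊆ (∨-xor-∨ a b s t) (boundaryFrom-∪ s t S T)

∣∂S∪T∣≤∣∂S∣+∣∂T∣ : (S T : Subset n) → ∣ ∂ (S ∪ T) ∣ ≤ ∣ ∂ S ∣ + ∣ ∂ T ∣
∣∂S∪T∣≤∣∂S∣+∣∂T∣ S T =
  ≤-trans (p⊆q⇒∣p∣≤∣q∣ (boundaryFrom-∪ false false S T)) (∣p∪q∣≤∣p∣+∣q∣ (∂ S) (∂ T))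

∂-nonempty : ∀ {n} (S : Subset n) → Nonempty S → 0 < ∣ ∂ S ∣
∂-nonempty {n} S (i , i∈S) = n≢0⇒n>0 λ ∣∂S∣≡0 →
  ∉⊥ (subst (i ∈_) (boundaryFrom-injective false (trans (∣p∣≡0⇒p≡⊥ ∣∂S∣≡0) (sym (∂-⊥ n)))) i∈S)

subsetOf : (ℕ → Bool) → Subset n
subsetOf P = tabulate (λ i → P (toℕ i))

between : ℕ → ℕ → ℕ → Bool
between a b m = (a ≤ᵇ m) ∧ (m ≤ᵇ b)

interval≡subsetOf-between : (a b : Fin n) → interval a b ≡ subsetOf (between (toℕ a) (toℕ b))
interval≡subsetOf-between a b = tabulate-cong λ i →
  cong₂ _∧_ (isYes≗does (toℕ a ≤? toℕ i)) (isYes≗does (toℕ i ≤? toℕ b))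

subsetOf-false : subsetOf {n} (λ _ → false) ≡ ∅
subsetOf-false {zero}  = refl
subsetOf-false {suc n} = cong (outside ∷_) subsetOf-false

∣∂-false∣≡0 : ∀ n → ∣ ∂ (subsetOf {n} (λ _ → false)) ∣ ≡ 0
∣∂-false∣≡0 n = trans (cong (λ X → ∣ ∂ X ∣) (subsetOf-false {n})) (∣∂⊥∣≡0 n)

≤ᵇ-suc : ∀ m n → (suc m ≤ᵇ suc n) ≡ (m ≤ᵇ n)
≤ᵇ-suc zero    n = refl
≤ᵇ-suc (suc m) n = refl

∣boundaryFrom-true-initial∣≤1 : ∀ b n → ∣ boundaryFrom true (subsetOf {n} (λ m → suc m ≤ᵇ b)) ∣ ≤ 1
∣boundaryFrom-true-initial∣≤1 b       zero    = ≤-refl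
∣boundaryFrom-true-initial∣≤1 zero    (suc n) = s≤s (≤-reflexive (∣∂-false∣≡0 n))
∣boundaryFrom-true-initial∣≤1 (suc b) (suc n) =
  subst (λ X → ∣ boundaryFrom true X ∣ ≤ 1) (tabulate-cong {n = n} λ i → sym (≤ᵇ-suc (suc (toℕ i)) b))
    (∣boundaryFrom-true-initial∣≤1 b n)

∣∂-between∣≤2 : ∀ a b n → ∣ ∂ (subsetOf {n} (between a b)) ∣ ≤ 2
∣∂-between∣≤2 a       b       zero    = z≤n
∣∂-between∣≤2 zero    b       (suc n) = s≤s (∣boundaryFrom-true-initial∣≤1 b n)
∣∂-between∣≤2 (suc a) zero    (suc n) =
  ≤-trans (≤-reflexive (trans (cong (λ X → ∣ ∂ X ∣) (tabulate-cong {n = n} λ i → ∧-zeroʳ _))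
                              (∣∂-false∣≡0 n)))
          z≤n
∣∂-between∣≤2 (suc a) (suc b) (suc n) =
  subst (λ X → ∣ ∂ X ∣ ≤ 2)
    (tabulate-cong {n = n} λ i → sym (cong₂ _∧_ (≤ᵇ-suc a (toℕ i)) (≤ᵇ-suc (toℕ i) b)))
    (∣∂-between∣≤2 a b n)

∣∂-interval∣≤2 : (a b : Fin n) → ∣ ∂ (interval a b) ∣ ≤ 2
∣∂-interval∣≤2 {n} a b rewrite interval≡subsetOf-between a b = ∣∂-between∣≤2 (toℕ a) (toℕ b) n

∣∂-unionOfIntervals∣≤2*length : (ivs : List (Fin n × Fin n)) →
  ∣ ∂ (unionOfIntervals ivs) ∣ ≤ 2 * length ivs
∣∂-unionOfIntervals∣≤2*length {n} [] = ≤-reflexive (∣∂⊥∣≡0 n)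
∣∂-unionOfIntervals∣≤2*length ((a , b) ∷ ivs) = begin
  ∣ ∂ (interval a b ∪ unionOfIntervals ivs) ∣           ≤⟨ ∣∂S∪T∣≤∣∂S∣+∣∂T∣ (interval a b) (unionOfIntervals ivs) ⟩
  ∣ ∂ (interval a b) ∣ + ∣ ∂ (unionOfIntervals ivs) ∣
    ≤⟨ +-mono-≤ (∣∂-interval∣≤2 a b) (∣∂-unionOfIntervals∣≤2*length ivs) ⟩
  2 + 2 * length ivs                                   ≡⟨ sym (*-suc 2 (length ivs)) ⟩
  2 * suc (length ivs)                                 ∎
  where open ≤-Reasoning

InI⇒∣∂∣≤2k : ∀ k {S : Subset n} → InI k S → ∣ ∂ S ∣ ≤ 2 * k
InI⇒∣∂∣≤2k k (_ , ivs , length≤k , _ , refl) =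
  ≤-trans (∣∂-unionOfIntervals∣≤2*length ivs) (*-monoʳ-≤ 2 length≤k)

parity : (A → Bool) → List A → Bool
parity f = foldr (λ x b → f x xor b) false

parity-cong : ∀ {f g : A → Bool} → (∀ x → f x ≡ g x) → ∀ xs → parity f xs ≡ parity g xs
parity-cong f≗g []       = refl
parity-cong f≗g (x ∷ xs) = cong₂ _xor_ (f≗g x) (parity-cong f≗g xs)

parity-xor : ∀ (f g : A → Bool) xs → parity (λ x → f x xor g x) xs ≡ parity f xs xor parity g xs
parity-xor f g []       = refl
parity-xor f g (x ∷ xs) =
  trans (cong ((f x xor g x) xor_) (parity-xor f g xs)) (interchange (f x) (g x) (parity f xs) (parity g xs))

parity-xor-true⁻ : ∀ (f g : A → Bool) xs → parity (λ x → f x xor g x) xs ≡ true →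
  parity f xs ≡ true ⊎ parity g xs ≡ true
parity-xor-true⁻ f g xs odd = xor-true⁻ (parity f xs) (trans (sym (parity-xor f g xs)) odd)

parity-true⇒ : ∀ (f : A → Bool) xs → parity f xs ≡ true → ∃ λ x → f x ≡ true
parity-true⇒ f (x ∷ xs) odd with f x in fx
... | true  = x , fx
... | false = parity-true⇒ f xs odd

parity-false : ∀ {f : A → Bool} xs → (∀ {x} → x List.∈ xs → f x ≢ true) → parity f xs ≡ false
parity-false []       _    = refl
parity-false (x ∷ xs) none rewrite ¬-not (none (here refl)) = parity-false xs (λ x∈ → none (there x∈))

parity-unique : ∀ {f : A → Bool} {xs x} → Unique xs → x List.∈ xs → f x ≡ true →
  (∀ {y} → y List.∈ xs → f y ≡ true → y ≡ x) → parity f xs ≡ true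
parity-unique (x∉xs ∷ _) (here refl) fx≡true only rewrite fx≡true =
  cong not (parity-false _ λ y∈xs fy≡true → All.lookup x∉xs y∈xs (sym (only (there y∈xs) fy≡true)))
parity-unique {f = f} {y ∷ xs} (y∉xs ∷ unique) (there x∈xs) fx≡true only with f y in fy
... | true  = ⊥-elim (All.lookup y∉xs x∈xs (only (here refl) fy))
... | false = parity-unique unique x∈xs fx≡true (λ z∈xs → only (there z∈xs))

all∈ : Subset n → (Fin n → Bool) → Bool
all∈ []            φ = true
all∈ (inside  ∷ D) φ = φ zero ∧ all∈ D (λ j → φ (suc j))
all∈ (outside ∷ D) φ = all∈ D (λ j → φ (suc j))

all∈-cong : ∀ (D : Subset n) {φ ψ} → (∀ j → φ j ≡ ψ j) → all∈ D φ ≡ all∈ D ψ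
all∈-cong []            φ≗ψ = refl
all∈-cong (inside  ∷ D) φ≗ψ = cong₂ _∧_ (φ≗ψ zero) (all∈-cong D (λ j → φ≗ψ (suc j)))
all∈-cong (outside ∷ D) φ≗ψ = all∈-cong D (λ j → φ≗ψ (suc j))

⊆⇒all∈-lookup : {p q : Subset n} → p ⊆ q → all∈ p (lookup q) ≡ true
⊆⇒all∈-lookup {p = []}          {[]}    _   = refl
⊆⇒all∈-lookup {p = outside ∷ p} {_ ∷ q} p⊆q = ⊆⇒all∈-lookup (drop-∷-⊆ p⊆q)
⊆⇒all∈-lookup {p = inside  ∷ p} {_ ∷ q} p⊆q with p⊆q here
... | here = ⊆⇒all∈-lookup (drop-∷-⊆ p⊆q)

all∈-lookup⇒⊆ : {p q : Subset n} → all∈ p (lookup q) ≡ true → p ⊆ q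
all∈-lookup⇒⊆ {p = []}          {[]}    _    ()
all∈-lookup⇒⊆ {p = outside ∷ p} {_ ∷ q} test = ∷-⊆ (λ ()) (all∈-lookup⇒⊆ test)
all∈-lookup⇒⊆ {p = inside  ∷ p} {_ ∷ q} test =
  ∷-⊆ (λ _ → proj₁ (∧-true⁻ test)) (all∈-lookup⇒⊆ (proj₂ (∧-true⁻ test)))

∧-xor-expand : ∀ w a b r → w ∧ ((a xor b) ∧ r) ≡ ((w ∧ a) ∧ r) xor ((w ∧ b) ∧ r)
∧-xor-expand w a b r = begin
  w ∧ ((a xor b) ∧ r)                  ≡⟨ cong (w ∧_) (∧-distribʳ-xor r a b) ⟩
  w ∧ ((a ∧ r) xor (b ∧ r))            ≡⟨ ∧-distribˡ-xor w (a ∧ r) (b ∧ r) ⟩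
  (w ∧ (a ∧ r)) xor (w ∧ (b ∧ r))      ≡⟨ sym (cong₂ _xor_ (∧-assoc w a r) (∧-assoc w b r)) ⟩
  ((w ∧ a) ∧ r) xor ((w ∧ b) ∧ r)      ∎
  where open ≡-Reasoning

parity-expand : ∀ {A B : Set} (ev : A → B → Bool) (lo hi : Fin n → B) (D : Subset n)
  (w : A → Bool) (xs : List A) →
  parity (λ S → w S ∧ all∈ D (λ j → ev S (lo j) xor ev S (hi j))) xs ≡ true →
  ∃ λ R → length R ≡ ∣ D ∣ × parity (λ S → w S ∧ all (ev S) R) xs ≡ true
parity-expand ev lo hi [] w xs odd = [] , refl , odd
parity-expand ev lo hi (outside ∷ D) w xs odd =
  parity-expand ev (λ j → lo (suc j)) (λ j → hi (suc j)) D w xs odd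
parity-expand {A = A} {B = B} ev lo hi (inside ∷ D) w xs odd =
  let (c , oddᶜ) = choose (parity-xor-true⁻ (term (lo zero)) (term (hi zero)) xs (trans (sym split) odd))
      (R , ∣R∣≡∣D∣ , oddᴿ) =
        parity-expand ev (λ j → lo (suc j)) (λ j → hi (suc j)) D (λ S → w S ∧ ev S c) xs oddᶜ
  in c ∷ R , cong suc ∣R∣≡∣D∣ ,
     trans (parity-cong (λ S → sym (∧-assoc (w S) (ev S c) (all (ev S) R))) xs) oddᴿ
  where
  rest : A → Bool
  rest S = all∈ D (λ j → ev S (lo (suc j)) xor ev S (hi (suc j)))
  term : B → A → Bool
  term c S = (w S ∧ ev S c) ∧ rest S
  Odd : B → Set
  Odd c = parity (term c) xs ≡ true
  choose : Odd (lo zero) ⊎ Odd (hi zero) → ∃ Odd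
  choose = [ (lo zero ,_) , (hi zero ,_) ]′
  split : parity (λ S → w S ∧ ((ev S (lo zero) xor ev S (hi zero)) ∧ rest S)) xs
        ≡ parity (λ S → term (lo zero) S xor term (hi zero) S) xs
  split = parity-cong (λ S → ∧-xor-expand (w S) (ev S (lo zero)) (ev S (hi zero)) (rest S)) xs

extend-suc-lookup : ∀ b (S : Subset n) i → extend b S (suc (toℕ i)) ≡ lookup S i
extend-suc-lookup b (s ∷ S) zero    = refl
extend-suc-lookup b (s ∷ S) (suc i) = extend-suc-lookup s S i

extend-suc-true⇒ : ∀ b (S : Subset n) m → extend b S (suc m) ≡ true → ∃ λ (i : Fin n) → m ≡ toℕ i
extend-suc-true⇒ b []      m       ()
extend-suc-true⇒ b (s ∷ S) zero    _ = zero , refl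
extend-suc-true⇒ b (s ∷ S) (suc m) h = let (i , m≡i) = extend-suc-true⇒ s S m h in suc i , cong suc m≡i

-- Index 0 and the indices past n carry the padding 0, so a monomial that is 1 at some S₀ only
-- involves genuine points of [n].
monomial-points : (S₀ : Subset n) (R : List ℕ) → all (extend false S₀) R ≡ true →
  ∃ λ (is : List (Fin n)) → length is ≡ length R × (∀ S → all (extend false S) R ≡ all (lookup S) is)
monomial-points S₀ []          _ = [] , refl , λ _ → refl
monomial-points S₀ (zero ∷ R)  ()
monomial-points S₀ (suc m ∷ R) h =
  let (i , m≡i) = extend-suc-true⇒ false S₀ m (proj₁ (∧-true⁻ h))
      (is , ∣is∣≡∣R∣ , eq) = monomial-points S₀ R (proj₂ (∧-true⁻ h))
  in i ∷ is , cong suc ∣is∣≡∣R∣ , λ S →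
       cong₂ _∧_ (trans (cong (λ k → extend false S (suc k)) m≡i) (extend-suc-lookup false S i)) (eq S)

indPow-const : ∀ d (S : Subset n) i → indPow (suc d) S (λ _ → i) ≡ lookup S i
indPow-const zero    S i = ∧-identityʳ (lookup S i)
indPow-const (suc d) S i = trans (cong (lookup S i ∧_) (indPow-const d S i)) (∧-idem (lookup S i))

indPow-listing : ∀ d (i : Fin n) is → length is ≤ d →
  ∃ λ (x : Fin (suc d) → Fin n) → ∀ S → indPow (suc d) S x ≡ all (lookup S) (i ∷ is)
indPow-listing d       i []       _ = (λ _ → i) , λ S → trans (indPow-const d S i) (sym (∧-identityʳ _))
indPow-listing (suc d) i (j ∷ is) (s≤s ∣is∣≤d) =
  let (x , eq) = indPow-listing d j is ∣is∣≤d
  in (λ { zero → i ; (suc k) → x k }) , λ S → cong (lookup S i ∧_) (eq S)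

odd-monomial⇒odd-point : ∀ d (L : List (Subset n)) (R : List ℕ) → 0 < length R → length R ≤ suc d →
  parity (λ S → all (extend false S) R) L ≡ true → ∃ λ (x : Fin (suc d) → Fin n) → sumF2 (suc d) L x ≡ true
odd-monomial⇒odd-point d L R 0<∣R∣ ∣R∣≤1+d odd with parity-true⇒ _ L odd
... | S₀ , S₀-monomial with monomial-points S₀ R S₀-monomial
...   | [] , 0≡∣R∣ , _ = ⊥-elim (<⇒≢ 0<∣R∣ 0≡∣R∣)
...   | i ∷ is , ∣is∣≡∣R∣ , eq =
  let (x , x-eq) = indPow-listing d i is (≤-pred (subst (_≤ suc d) (sym ∣is∣≡∣R∣) ∣R∣≤1+d))
  in x , trans (parity-cong (λ S → trans (x-eq S) (sym (eq S))) L) odd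

-- S₀ is the only member of L whose boundary contains ∂S₀: its boundary is the largest one and ∂
-- is injective.
odd-boundary-monomial : ∀ {L} {S₀ : Subset n} → Unique L → S₀ List.∈ L →
  (∀ {S} → S List.∈ L → ∣ ∂ S ∣ ≤ ∣ ∂ S₀ ∣) →
  ∃ λ R → length R ≡ ∣ ∂ S₀ ∣ × parity (λ S → all (extend false S) R) L ≡ true
odd-boundary-monomial {L = L} {S₀} unique S₀∈L maximal =
  parity-expand (extend false) toℕ (λ j → suc (toℕ j)) (∂ S₀) (λ _ → true) L
    (trans (parity-cong (λ S → all∈-cong (∂ S₀) (λ j → sym (lookup-boundaryFrom false S j))) L) only-S₀)
  where
  only-S₀ : parity (λ S → all∈ (∂ S₀) (lookup (∂ S))) L ≡ true
  only-S₀ = parity-unique unique S₀∈L (⊆⇒all∈-lookup {p = ∂ S₀} ⊆-refl) λ S∈L ∂S₀⊆∂S →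
    sym (boundaryFrom-injective false (p⊆q∧∣q∣≤∣p∣⇒p≡q (all∈-lookup⇒⊆ ∂S₀⊆∂S) (maximal S∈L)))

proposition3p1 : (k d n : ℕ) → 0 < k → 0 < d → 0 < n → d ≡ 2 * k → d ≤ n →
    (L : List (Subset n)) → Unique L → All (InI k) L → L ≢ [] →
    ∃ λ (x : Fin d → Fin n) → sumF2 d L x ≡ true
proposition3p1 k zero    n _ () _ _ _ _ _ _ _
proposition3p1 k (suc d) n _ _  _ _ _ [] _ _ L≢[] = ⊥-elim (L≢[] refl)
proposition3p1 k (suc d) n _ _  _ d≡2k _ L@(S ∷ L′) unique intervals _ =
  let (R , ∣R∣≡∣∂S₀∣ , odd) = odd-boundary-monomial unique S₀∈L maximal
  in odd-monomial⇒odd-point d L R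
       (subst (0 <_) (sym ∣R∣≡∣∂S₀∣) (∂-nonempty S₀ (proj₁ S₀∈I)))
       (subst₂ _≤_ (sym ∣R∣≡∣∂S₀∣) (sym d≡2k) (InI⇒∣∂∣≤2k k S₀∈I))
       odd
  where
  S₀ : Subset n
  S₀ = argmax (λ T → ∣ ∂ T ∣) S L′
  S₀∈L : S₀ List.∈ L
  S₀∈L = argmax-all (λ T → ∣ ∂ T ∣) {P = List._∈ L} (here refl) (All.tabulate there)
  S₀∈I : InI k S₀
  S₀∈I = All.lookup intervals S₀∈L
  maximal : ∀ {T} → T List.∈ L → ∣ ∂ T ∣ ≤ ∣ ∂ S₀ ∣
  maximal (here refl)  = f[⊥]≤f[argmax] {f = λ T → ∣ ∂ T ∣} S L′
  maximal (there T∈L′) = All.lookup (f[xs]≤f[argmax] {f = λ T → ∣ ∂ T ∣} S L′) T∈L′
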